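{- Let $n,k\ge1$ and consider rowmotion $\rho$ acting on $\mathcal{J}({\sf C}_n\times[k])$. For $i\in[n]$ and $a\in[k]$ let $\chi_{(i,a)}$ be the indicator function of the element $(b_i,a)$, i.e. $\chi_{(i,a)}(I)=1$ iff $(b_i,a)\in I$. Then for all $i,j\in[n]$ and $a\in[k]$, the statistic $\chi_{(i,a)}-\chi_{(j,a)}$ is $0$-mesic.
   Context: The claw poset ${\sf C}_n=\{b_1,\dots,b_n,\widehat0\}$ has relations $\widehat0<b_i$ for all $i$ and no others. ${\sf C}_n\times[k]$ carries the product order. $\mathcal{J}(P)$ is the set of order ideals of $P$; rowmotion $\rho$ sends an order ideal $I$ to the order ideal generated by the minimal elements of $P\setminus I$. A statistic is $c$-mesic under $\rho$ if its average over every $\rho$-orbit equals $c$. -}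

module Defs where

open import Data.Bool using (Bool; true; false; _∧_; not; if_then_else_)
open import Data.Nat using (ℕ; zero; suc; _≤ᵇ_; _<_)
open import Data.Fin using (Fin; toℕ; _≟_)
open import Data.Maybe using (Maybe; just; nothing)
open import Data.Product using (_×_; _,_)
open import Data.List using (List; _∷_; map; allFin; cartesianProduct)
open import Data.Bool.ListAction using (any; all)
open import Data.Integer using (ℤ; +_; _-_; _+_)
open import Relation.Nullary.Decidable using (⌊_⌋)
open import Relation.Binary.PropositionalEquality using (_≡_)

-- The claw poset C_n : nothing = 0̂, just i = b_i (i : Fin n).
Claw : ℕ → Set
Claw n = Maybe (Fin n)

_≤C_ : ∀ {n} → Claw n → Claw n → Bool
nothing ≤C _        = true
just i  ≤C nothing  = false
just i  ≤C just j   = ⌊ i ≟ j ⌋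

Elt : ℕ → ℕ → Set
Elt n k = Claw n × Fin k

_≤P_ : ∀ {n k} → Elt n k → Elt n k → Bool
(x , a) ≤P (y , b) = (x ≤C y) ∧ (toℕ a ≤ᵇ toℕ b)

_<P_ : ∀ {n k} → Elt n k → Elt n k → Bool
p <P q = (p ≤P q) ∧ not (q ≤P p)

elements : ∀ n k → List (Elt n k)
elements n k = cartesianProduct (nothing ∷ map just (allFin n)) (allFin k)

Subset : ℕ → ℕ → Set
Subset n k = Elt n k → Bool

IsOrderIdeal : ∀ {n k} → Subset n k → Set
IsOrderIdeal {n} {k} I = ∀ (p q : Elt n k) → (p ≤P q) ≡ true → I q ≡ true → I p ≡ true

isMinOfComplement : ∀ {n k} → Subset n k → Elt n k → Bool
isMinOfComplement {n} {k} S m =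
  not (S m) ∧ all (λ m′ → not (not (S m′) ∧ (m′ <P m))) (elements n k)

rowmotion : ∀ {n k} → Subset n k → Subset n k
rowmotion {n} {k} S y = any (λ m → isMinOfComplement S m ∧ (y ≤P m)) (elements n k)

iterate : ∀ {A : Set} → (A → A) → ℕ → A → A
iterate f zero    x = x
iterate f (suc t) x = f (iterate f t x)

_≐_ : ∀ {n k} → Subset n k → Subset n k → Set
_≐_ {n} {k} S T = ∀ (x : Elt n k) → S x ≡ T x

IsOrbitSize : ∀ {n k} → Subset n k → ℕ → Set
IsOrbitSize I p =
  (0 < p) × (iterate rowmotion p I ≐ I)
  × (∀ q → 0 < q → q < p → iterate rowmotion q I ≐ I → Data.Empty.⊥)
  where import Data.Empty

χ : ∀ {n k} → Fin n → Fin k → Subset n k → ℤ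
χ i a S = if S (just i , a) then + 1 else + 0

orbitSum : ∀ {n k} → (Subset n k → ℤ) → Subset n k → ℕ → ℤ
orbitSum f I zero    = + 0
orbitSum f I (suc p) = orbitSum f I p + f (iterate rowmotion p I)

IsZeroMesic : ∀ {n k} → (Subset n k → ℤ) → Set
IsZeroMesic {n} {k} f =
  ∀ (I : Subset n k) → IsOrderIdeal I → ∀ p → IsOrbitSize I p → orbitSum f I p ≡ + 0

-- Encode an order ideal of C_n × [k] by its column heights: r over 0̂ and a_i ≤ r over b_i. Rowmotion
-- sends a_i to a_i + 1 if a_i < r and to 0 otherwise, and r to r + 1 if r < k (to the largest new a_i
-- if r = k). Mark the heights a_i on the cycle of positions 0, …, k + 1, together with a hole at r, moved
-- to k + 1 when some a_i = r. One rowmotion step rotates this marked set by one position, and each a_i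
-- moves like a particle that climbs while a mark lies above it in 0, …, k and otherwise falls to 0.
-- After k + 2 steps a particle has passed to the next mark below the topmost one (cyclically), so any
-- two columns run through the same heights up to a time shift, which does not change a sum over an orbit.
module Submission where

open import Defs
open import Data.Nat using (ℕ; NonZero)
open import Data.Fin using (Fin)
open import Data.Integer using (_-_)

open import Data.Bool using (Bool; true; false; T; not; _∧_; if_then_else_)
open import Data.Bool.ListAction using (and; or)
open import Data.Bool.Properties using (T-∧; T-≡; ¬-not)
open import Data.Empty using (⊥-elim)
open import Data.Fin using (zero; suc; toℕ; fromℕ<; _≟_)
open import Data.Fin.Properties using (toℕ<n; toℕ-fromℕ<; any?)
open import Data.Integer as ℤ using (ℤ)
import Data.Integer.Properties as ℤ
open import Algebra.Properties.AbelianGroup ℤ.+-0-abelianGroup using (∙-cancelʳ)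
import Data.Integer.Tactic.RingSolver as ℤ-Solver
open import Data.List using (_∷_; map; allFin)
open import Data.List.Membership.Propositional using (_∈_)
open import Data.List.Membership.Propositional.Properties using (∈-cartesianProduct⁺; ∈-map⁺; ∈-allFin)
open import Data.List.Properties using (map-cong)
open import Data.List.Relation.Unary.All as All using (tabulate)
open import Data.List.Relation.Unary.All.Properties using (all⁺; all⁻)
open import Data.List.Relation.Unary.Any as Any using (here; there; satisfied)
open import Data.List.Relation.Unary.Any.Properties using (any⁺; any⁻)
open import Data.Maybe using (nothing; just)
open import Data.Nat using (zero; suc; _+_; _∸_; _⊔_; _≤_; _<_; z≤n; s≤s; z<s; _<?_; _≤ᵇ_; >-nonZero⁻¹)
open import Data.Nat.Properties hiding (_≟_)
open import Data.Nat.Properties using () renaming (_≟_ to _≟ℕ_)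
open import Data.Nat.Tactic.RingSolver using (solve-∀)
open import Data.Product using (∃; _×_; _,_; proj₁; proj₂)
open import Data.Sum using (_⊎_; inj₁; inj₂)
open import Data.Unit using (tt)
open import Function using (_∘_)
open import Function.Bundles using (_⇔_; mk⇔; Equivalence)
open import Function.Properties.Equivalence using (⇔-setoid)
open import Level using (0ℓ)
open import Relation.Binary.PropositionalEquality
import Relation.Binary.Reasoning.Setoid as SetoidReasoning
open import Relation.Nullary using (¬_; Dec; yes; no; does; contradiction)
open import Relation.Nullary.Decidable using (⌊_⌋; _×-dec_; _⊎-dec_; dec-true; dec-false; does-⇔)

open Equivalence using (to; from)

iterate-+ : ∀ {A : Set} (f : A → A) t d x → iterate f t (iterate f d x) ≡ iterate f (t + d) x
iterate-+ f zero    d x = refl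
iterate-+ f (suc t) d x = cong f (iterate-+ f t d x)

least-between : ∀ (P : ℕ → Bool) {x w} → x ≤ w → P w ≡ true →
                ∃ λ m → x ≤ m × m ≤ w × P m ≡ true × (∀ z → x ≤ z → z < m → P z ≡ false)
least-between P {x} x≤w Pw with m≤n⇒∃[o]m+o≡n x≤w
... | d , refl = search x d Pw
  where
  search : ∀ x d → P (x + d) ≡ true →
           ∃ λ m → x ≤ m × m ≤ x + d × P m ≡ true × (∀ z → x ≤ z → z < m → P z ≡ false)
  search x d P[x+d] with P x in Px
  ... | true = x , ≤-refl , m≤m+n x d , Px , λ z x≤z z<x → contradiction (≤-<-trans x≤z z<x) (n≮n x)
  search x zero P[x+0] | false =
    contradiction (trans (sym Px) (trans (cong P (sym (+-identityʳ x))) P[x+0])) λ ()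
  search x (suc d) P[x+1+d] | false with search (suc x) d (trans (cong P (sym (+-suc x d))) P[x+1+d])
  ... | m , x<m , m≤ , Pm , below = m , <⇒≤ x<m , subst (m ≤_) (sym (+-suc x d)) m≤ , Pm , below′
    where
    below′ : ∀ z → x ≤ z → z < m → P z ≡ false
    below′ z x≤z z<m with m≤n⇒m<n∨m≡n x≤z
    ... | inj₁ x<z  = below z x<z z<m
    ... | inj₂ refl = Px

module Particles (k : ℕ) where

  period : ℕ
  period = suc (suc k)

  Env : Set
  Env = ℕ → Bool

  rotate : Env → Env
  rotate E zero    = E (suc k)
  rotate E (suc y) = E y

  infix 4 _≈_
  _≈_ : Env → Env → Set
  E ≈ E′ = ∀ y → y ≤ suc k → E y ≡ E′ y

  PointAbove : Env → ℕ → Set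
  PointAbove E x = ∃ λ y → y < suc k × x < y × E y ≡ true

  pointAbove? : ∀ E x → Dec (PointAbove E x)
  pointAbove? E x = anyUpTo? (λ y → x <? y ×-dec E y Data.Bool.≟ true) (suc k)

  move : Env → ℕ → ℕ
  move E x = if does (pointAbove? E x) then suc x else 0

  position : Env → ℕ → ℕ → ℕ
  position E x zero    = x
  position E x (suc t) = move (iterate rotate t E) (position E x t)

  move-up : ∀ {E x} → PointAbove E x → move E x ≡ suc x
  move-up {E} {x} p rewrite dec-true (pointAbove? E x) p = refl

  move-drop : ∀ {E x} → ¬ PointAbove E x → move E x ≡ 0
  move-drop {E} {x} ¬p rewrite dec-false (pointAbove? E x) ¬p = refl

  move-cong : ∀ {E E′} → E ≈ E′ → ∀ x → move E x ≡ move E′ x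
  move-cong {E} {E′} E≈E′ x = cong (if_then suc x else 0)
    (does-⇔ (mk⇔ (transport E≈E′) (transport (λ y y≤ → sym (E≈E′ y y≤))))
            (pointAbove? E x) (pointAbove? E′ x))
    where
    transport : ∀ {F G} → F ≈ G → PointAbove F x → PointAbove G x
    transport F≈G (y , y<1+k , x<y , Fy) = y , y<1+k , x<y , trans (sym (F≈G y (<⇒≤ y<1+k))) Fy

  rotate-cong : ∀ {E E′} → E ≈ E′ → rotate E ≈ rotate E′
  rotate-cong E≈E′ zero    _   = E≈E′ (suc k) ≤-refl
  rotate-cong E≈E′ (suc y) y< = E≈E′ y (<⇒≤ y<)

  rotate^-cong : ∀ {E E′} t → E ≈ E′ → iterate rotate t E ≈ iterate rotate t E′
  rotate^-cong zero    E≈E′ = E≈E′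
  rotate^-cong (suc t) E≈E′ = rotate-cong (rotate^-cong t E≈E′)

  rotate^-shift : ∀ E t x → iterate rotate t E (t + x) ≡ E x
  rotate^-shift E zero    x = refl
  rotate^-shift E (suc t) x = rotate^-shift E t x

  rotate^-wrap : ∀ E t y z → y + period ≡ z + t → z ≤ suc k → iterate rotate t E y ≡ E z
  rotate^-wrap E zero y z eq z≤ = contradiction
    (≤-trans (m≤n+m period y) (subst (_≤ suc k) (sym (trans eq (+-identityʳ z))) z≤)) (n≮n (suc k))
  rotate^-wrap E (suc t) zero z eq z≤ = subst (λ y → iterate rotate t E y ≡ E z)
    (suc-injective (trans (+-comm (suc t) z) (sym eq))) (rotate^-shift E t z)
  rotate^-wrap E (suc t) (suc y) z eq z≤ = rotate^-wrap E t y z (suc-injective (trans eq (+-suc z t))) z≤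

  rotate^-period : ∀ E → iterate rotate period E ≈ E
  rotate^-period E y = rotate^-wrap E period y y refl

  position-cong : ∀ {E E′} → E ≈ E′ → ∀ x t → position E x t ≡ position E′ x t
  position-cong E≈E′ x zero    = refl
  position-cong {E} {E′} E≈E′ x (suc t) = begin
    move (iterate rotate t E) (position E x t)   ≡⟨ cong (move _) (position-cong E≈E′ x t) ⟩
    move (iterate rotate t E) (position E′ x t)  ≡⟨ move-cong (rotate^-cong t E≈E′) _ ⟩
    move (iterate rotate t E′) (position E′ x t) ∎
    where open ≡-Reasoning

  position-+ : ∀ E x t d → position E x (t + d) ≡ position (iterate rotate d E) (position E x d) t
  position-+ E x zero    d = refl
  position-+ E x (suc t) d rewrite position-+ E x t d | iterate-+ rotate t d E = refl

  climb : ∀ {E x y} d → E y ≡ true → x < y → d + y ≤ suc k → position E x d ≡ d + x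
  climb zero Ey x<y d+y≤ = refl
  climb {E} {x} {y} (suc d) Ey x<y d+y< =
    trans (cong (move (iterate rotate d E)) (climb d Ey x<y (<⇒≤ d+y<)))
          (move-up (d + y , d+y< , +-monoʳ-< d x<y , trans (rotate^-shift E d y) Ey))

  Gap : Env → ℕ → ℕ → Set
  Gap E v w = ∀ z → v < z → z < w → E z ≡ false

  fall : ∀ {E v w} t → v < w → E w ≡ true → Gap E v w → t + w ≡ suc k → position E v (suc t) ≡ 0
  fall {E} {v} {w} t v<w Ew gap t+w≡ =
    trans (cong (move (iterate rotate t E)) (climb t Ew v<w (≤-reflexive t+w≡))) (move-drop no-point)
    where
    no-point : ¬ PointAbove (iterate rotate t E) (t + v)
    no-point (y , y<1+k , t+v<y , Ey) with m≤n⇒∃[o]m+o≡n (≤-trans (m≤m+n t v) (<⇒≤ t+v<y))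
    ... | z , refl = contradiction (trans (sym (gap z v<z z<w)) (trans (sym (rotate^-shift E t z)) Ey)) λ ()
      where
      v<z : v < z
      v<z = +-cancelˡ-< t v z t+v<y
      z<w : z < w
      z<w = +-cancelˡ-< t z w (subst (t + z <_) (sym t+w≡) y<1+k)

  arrive : ∀ {E h v w} T → h ≤ suc k → E h ≡ true → w < h → T + w ≡ period → position E v T ≡ 0 →
           position E v period ≡ w
  arrive {E} {h} {v} {w} T h≤ Eh w<h T+w≡ fell with m≤n⇒∃[o]m+o≡n (<⇒≤ w<h)
  ... | d , refl = begin
    position E v period                                ≡⟨ cong (position E v) (trans (sym T+w≡) (+-comm T w)) ⟩
    position E v (w + T)                               ≡⟨ position-+ E v w T ⟩
    position (iterate rotate T E) (position E v T) w   ≡⟨ cong (λ x → position _ x w) fell ⟩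
    position (iterate rotate T E) 0 w                  ≡⟨ climb w point-at-d 0<d h≤ ⟩
    w + 0                                              ≡⟨ +-identityʳ w ⟩
    w                                                  ∎
    where
    open ≡-Reasoning
    0<d : 0 < d
    0<d = +-cancelˡ-< w 0 d (subst (_< w + d) (sym (+-identityʳ w)) w<h)
    shuffle : ∀ d T w → d + (T + w) ≡ (w + d) + T
    shuffle = solve-∀
    point-at-d : iterate rotate T E d ≡ true
    point-at-d = trans (rotate^-wrap E T d (w + d) (trans (cong (d +_) (sym T+w≡)) (shuffle d T w)) h≤) Eh

  revolution-next : ∀ {E h v w} → h ≤ suc k → E h ≡ true →
                    v < w → w < h → E w ≡ true → Gap E v w → position E v period ≡ w
  revolution-next {w = w} h≤ Eh v<w w<h Ew gap =
    arrive (suc t) h≤ Eh w<h (cong suc t+w≡) (fall t v<w Ew gap t+w≡)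
    where
    t : ℕ
    t = suc k ∸ w
    t+w≡ : t + w ≡ suc k
    t+w≡ = m∸n+n≡m (<⇒≤ (<-≤-trans w<h h≤))

  no-point-after-wrap : ∀ {E h u} t d → Gap E h period → (∀ z → z < u → E z ≡ false) →
                        t + u ≡ suc k → d + suc u ≡ h → ¬ PointAbove (iterate rotate t E) d
  no-point-after-wrap {E} {h} {u} t d empty nothing<u t+u≡ d+1+u≡h (y , y<1+k , d<y , Ey) with t ≤? y
  ... | yes t≤y with m≤n⇒∃[o]m+o≡n t≤y
  ...   | z , refl = contradiction (trans (sym (nothing<u z z<u)) (trans (sym (rotate^-shift E t z)) Ey)) λ ()
    where
    z<u : z < u
    z<u = +-cancelˡ-< t z u (subst (t + z <_) (sym t+u≡) y<1+k)
  no-point-after-wrap {E} {h} {u} t d empty nothing<u t+u≡ d+1+u≡h (y , y<1+k , d<y , Ey) | no t≰y =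
    contradiction (trans (sym (empty z h<z (s≤s z≤))) (trans (sym (rotate^-wrap E t y z eq z≤)) Ey)) λ ()
    where
    z : ℕ
    z = y + suc u
    shuffle : ∀ y t u → y + suc (t + u) ≡ (y + suc u) + t
    shuffle = solve-∀
    eq : y + period ≡ z + t
    eq = trans (cong (λ s → y + suc s) (sym t+u≡)) (shuffle y t u)
    z≤ : z ≤ suc k
    z≤ = subst (_≤ suc k) (sym (+-suc y u)) (subst (suc y + u ≤_) t+u≡ (+-monoˡ-≤ u (≰⇒> t≰y)))
    h<z : h < z
    h<z = subst (_< z) d+1+u≡h (+-monoˡ-< (suc u) d<y)

  refall : ∀ {E h v u} t d → Gap E h period → E u ≡ true → (∀ z → z < u → E z ≡ false) →
           t + h ≡ suc k → d + suc t + u ≡ suc k → position E v (suc t) ≡ 0 → position E v (suc (d + suc t)) ≡ 0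
  refall {E} {h} {v} {u} t d empty Eu nothing<u t+h≡ d+T+u≡ fell =
    trans (cong (move (iterate rotate (d + suc t) E)) climbed)
          (move-drop (no-point-after-wrap (d + suc t) d empty nothing<u d+T+u≡ d+1+u≡h))
    where
    open ≡-Reasoning
    shuffle : ∀ d t u → d + suc u + t ≡ d + suc t + u
    shuffle = solve-∀
    d+1+u≡h : d + suc u ≡ h
    d+1+u≡h = +-cancelʳ-≡ t (d + suc u) h (begin
      d + suc u + t    ≡⟨ shuffle d t u ⟩
      d + suc t + u    ≡⟨ d+T+u≡ ⟩
      suc k            ≡⟨ sym t+h≡ ⟩
      t + h            ≡⟨ +-comm t h ⟩
      h + t            ∎)
    point-at-u : iterate rotate (suc t) E (suc t + u) ≡ true
    point-at-u = trans (rotate^-shift E (suc t) u) Eu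
    climbed : position E v (d + suc t) ≡ d
    climbed = begin
      position E v (d + suc t)                                      ≡⟨ position-+ E v d (suc t) ⟩
      position (iterate rotate (suc t) E) (position E v (suc t)) d  ≡⟨ cong (λ x → position _ x d) fell ⟩
      position (iterate rotate (suc t) E) 0 d                       ≡⟨ climb d point-at-u z<s d+T+u≤ ⟩
      d + 0                                                         ≡⟨ +-identityʳ d ⟩
      d                                                             ∎
      where
      d+T+u≤ : d + (suc t + u) ≤ suc k
      d+T+u≤ = ≤-reflexive (trans (sym (+-assoc d (suc t) u)) d+T+u≡)

  -- Falls at time t₀ (no point between v and h), climbs on the point u, falls again, and climbs on h.
  revolution-wrap : ∀ {E h v u} → h ≤ suc k → E h ≡ true → Gap E h period → v < h → Gap E v h →
                    E u ≡ true → (∀ z → z < u → E z ≡ false) → u < h → position E v period ≡ u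
  revolution-wrap {E} {h} {v} {u} h≤ Eh empty v<h gap Eu nothing<u u<h =
    arrive (suc (d + suc t₀)) h≤ Eh u<h (cong suc d+T₀+u≡)
           (refall t₀ d empty Eu nothing<u t₀+h≡ d+T₀+u≡ (fall t₀ v<h Eh gap t₀+h≡))
    where
    t₀ : ℕ
    t₀ = suc k ∸ h
    t₀+h≡ : t₀ + h ≡ suc k
    t₀+h≡ = m∸n+n≡m h≤
    T₀+u≤ : suc t₀ + u ≤ suc k
    T₀+u≤ = subst (suc t₀ + u ≤_) t₀+h≡ (+-monoʳ-< t₀ u<h)
    d : ℕ
    d = suc k ∸ (suc t₀ + u)
    d+T₀+u≡ : d + suc t₀ + u ≡ suc k
    d+T₀+u≡ = trans (+-assoc d (suc t₀) u) (m∸n+n≡m T₀+u≤)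

  Shifted : Env → ℕ → ℕ → Set
  Shifted E v w = ∃ λ D → ∀ t → position E v (t + D) ≡ position E w t

  Shifted-refl : ∀ {E} v → Shifted E v v
  Shifted-refl v = 0 , λ t → cong (position _ v) (+-identityʳ t)

  Shifted-trans : ∀ {E u v w} → Shifted E u v → Shifted E v w → Shifted E u w
  Shifted-trans {E} {u} (D₁ , u→v) (D₂ , v→w) = D₂ + D₁ , λ t →
    trans (cong (position E u) (sym (+-assoc t D₂ D₁))) (trans (u→v (t + D₂)) (v→w t))

  Shifted-revolution : ∀ E v → Shifted E v (position E v period)
  Shifted-revolution E v = period , λ t → trans (position-+ E v t period) (position-cong (rotate^-period E) _ t)

  module _ {E h} (h≤ : h ≤ suc k) (Eh : E h ≡ true) (empty : Gap E h period) where

    shifted-up : ∀ fuel {v w} → w ≤ fuel + v →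
                 E v ≡ true → E w ≡ true → w < h → v ≤ w → Shifted E v w
    shifted-up fuel {v} {w} w≤ Ev Ew w<h v≤w with m≤n⇒m<n∨m≡n v≤w
    ... | inj₂ refl = Shifted-refl v
    shifted-up zero {v} {w} w≤ Ev Ew w<h v≤w | inj₁ v<w = contradiction (<-≤-trans v<w w≤) (n≮n v)
    shifted-up (suc fuel) {v} {w} w≤ Ev Ew w<h v≤w | inj₁ v<w with least-between E v<w Ew
    ... | w′ , v<w′ , w′≤w , Ew′ , gap = Shifted-trans
      (subst (Shifted E v) (revolution-next h≤ Eh v<w′ w′<h Ew′ gap) (Shifted-revolution E v))
      (shifted-up fuel w≤fuel+w′ Ew′ Ew w<h w′≤w)
      where
      w′<h : w′ < h
      w′<h = ≤-<-trans w′≤w w<h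
      w≤fuel+w′ : w ≤ fuel + w′
      w≤fuel+w′ = ≤-trans w≤ (subst (_≤ fuel + w′) (+-suc fuel v) (+-monoʳ-≤ fuel v<w′))

    shifted-wrap : ∀ fuel {u v} → h ≤ fuel + v → E v ≡ true → v < h →
                   E u ≡ true → (∀ z → z < u → E z ≡ false) → u < h → Shifted E v u
    shifted-wrap zero {v = v} h≤v Ev v<h Eu nothing<u u<h = contradiction (<-≤-trans v<h h≤v) (n≮n v)
    shifted-wrap (suc fuel) {u} {v} h≤fuel+v Ev v<h Eu nothing<u u<h with least-between E v<h Eh
    ... | w , v<w , w≤h , Ew , gap with m≤n⇒m<n∨m≡n w≤h
    ...   | inj₂ refl =
      subst (Shifted E v) (revolution-wrap h≤ Eh empty v<h gap Eu nothing<u u<h) (Shifted-revolution E v)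
    ...   | inj₁ w<h = Shifted-trans
      (subst (Shifted E v) (revolution-next h≤ Eh v<w w<h Ew gap) (Shifted-revolution E v))
      (shifted-wrap fuel h≤fuel+w Ew w<h Eu nothing<u u<h)
      where
      h≤fuel+w : h ≤ fuel + w
      h≤fuel+w = ≤-trans h≤fuel+v (subst (_≤ fuel + w) (+-suc fuel v) (+-monoʳ-≤ fuel v<w))

    shifted : ∀ {v w} → E v ≡ true → v < h → E w ≡ true → w < h → Shifted E v w
    shifted {v} {w} Ev v<h Ew w<h with least-between E z≤n Ew
    ... | u , _ , u≤w , Eu , below =
      Shifted-trans (shifted-wrap h (m≤m+n h v) Ev v<h Eu (λ z → below z z≤n) (≤-<-trans u≤w w<h))
                    (shifted-up w (m≤m+n w u) Eu Ew w<h u≤w)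

T-injective : ∀ {a b} → T a ⇔ T b → a ≡ b
T-injective {true}  {true}  _   = refl
T-injective {true}  {false} a⇔b = ⊥-elim (to a⇔b tt)
T-injective {false} {true}  a⇔b = ⊥-elim (from a⇔b tt)
T-injective {false} {false} _   = refl

T-not : ∀ {b} → T (not b) ⇔ (¬ T b)
T-not {true}  = mk⇔ (λ ()) (λ ¬t → ¬t tt)
T-not {false} = mk⇔ (λ _ ()) (λ _ → tt)

T-not-∧-not : ∀ {a b} → T (not (not a ∧ b)) ⇔ (T b → T a)
T-not-∧-not {true}          = mk⇔ (λ _ _ → tt) (λ _ → tt)
T-not-∧-not {false} {true}  = mk⇔ (λ ()) (λ b⇒a → b⇒a tt)
T-not-∧-not {false} {false} = mk⇔ (λ _ ()) (λ _ → tt)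

T-≤ᵇ∧≱ᵇ : ∀ a b → T ((a ≤ᵇ b) ∧ not (b ≤ᵇ a)) ⇔ a < b
T-≤ᵇ∧≱ᵇ a b = mk⇔
  (λ t → ≰⇒> (λ b≤a → to T-not (proj₂ (to (T-∧ {a ≤ᵇ b}) t)) (≤⇒≤ᵇ b≤a)))
  (λ a<b → from T-∧ (≤⇒≤ᵇ (<⇒≤ a<b) , from T-not (λ t → <⇒≱ a<b (≤ᵇ⇒≤ b a t))))

does≡true⇔ : ∀ {A : Set} (a? : Dec A) → does a? ≡ true ⇔ A
does≡true⇔ (yes a) = mk⇔ (λ _ → a) (λ _ → refl)
does≡true⇔ (no ¬a) = mk⇔ (λ ()) (λ a → contradiction a ¬a)

advance : ℕ → ℕ → ℕ
advance m v with v <? m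
... | yes _ = suc v
... | no  _ = 0

advance-cases : ∀ m v → (v < m × advance m v ≡ suc v) ⊎ (¬ v < m × advance m v ≡ 0)
advance-cases m v with v <? m
... | yes v<m = inj₁ (v<m , refl)
... | no  v≮m = inj₂ (v≮m , refl)

advance-< : ∀ {m v} → v < m → advance m v ≡ suc v
advance-< {m} {v} v<m with advance-cases m v
... | inj₁ (_ , advance≡) = advance≡
... | inj₂ (v≮m , _)      = contradiction v<m v≮m

advance-≤ : ∀ m v → advance m v ≤ m
advance-≤ m v with v <? m
... | yes v<m = v<m
... | no  _   = z≤n

<-advance : ∀ {m v c} → c < advance m v → v < m × c ≤ v
<-advance {m} {v} c< with v <? m
... | yes v<m = v<m , ≤-pred c<

maxᶠ : ∀ {n} → (Fin n → ℕ) → ℕ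
maxᶠ {zero}  f = 0
maxᶠ {suc n} f = f zero ⊔ maxᶠ (f ∘ suc)

≤-maxᶠ : ∀ {n} (f : Fin n → ℕ) i → f i ≤ maxᶠ f
≤-maxᶠ f zero    = m≤m⊔n _ _
≤-maxᶠ f (suc i) = ≤-trans (≤-maxᶠ (f ∘ suc) i) (m≤n⊔m (f zero) _)

maxᶠ-≤ : ∀ {n} (f : Fin n → ℕ) {b} → (∀ i → f i ≤ b) → maxᶠ f ≤ b
maxᶠ-≤ {zero}  f f≤ = z≤n
maxᶠ-≤ {suc n} f f≤ = ⊔-lub (f≤ zero) (maxᶠ-≤ (f ∘ suc) (f≤ ∘ suc))

<-maxᶠ : ∀ {n} (f : Fin n → ℕ) {c} → c < maxᶠ f → ∃ λ i → c < f i
<-maxᶠ {suc n} f {c} c< with ≤-total (maxᶠ (f ∘ suc)) (f zero)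
... | inj₁ rest≤ = zero , subst (c <_) (m≥n⇒m⊔n≡m rest≤) c<
... | inj₂ f₀≤ with <-maxᶠ (f ∘ suc) (subst (c <_) (m≤n⇒m⊔n≡n f₀≤) c<)
...   | i , c<fi = suc i , c<fi

maxᶠ-attained : ∀ {n} → Fin n → (f : Fin n → ℕ) → ∃ λ i → f i ≡ maxᶠ f
maxᶠ-attained {suc zero}    _ f = zero , sym (⊔-identityʳ (f zero))
maxᶠ-attained {suc (suc n)} _ f with ≤-total (maxᶠ (f ∘ suc)) (f zero) | maxᶠ-attained zero (f ∘ suc)
... | inj₁ rest≤ | _       = zero , sym (m≥n⇒m⊔n≡m rest≤)
... | inj₂ f₀≤   | i , fi≡ = suc i , trans fi≡ (sym (m≤n⇒m⊔n≡n f₀≤))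

column-boundary : ∀ {k m} (c : Fin k) → ¬ toℕ c < m →
                  (∀ (c′ : Fin k) → toℕ c′ < toℕ c → toℕ c′ < m) → toℕ c ≡ m
column-boundary {k} {m} c c≮m below = ≤-antisym (≮⇒≥ m≮c) (≮⇒≥ c≮m)
  where
  m≮c : ¬ m < toℕ c
  m≮c m<c = n≮n m (subst (_< m) m≡ (below (fromℕ< m<k) (subst (_< toℕ c) (sym m≡) m<c)))
    where
    m<k : m < k
    m<k = <-trans m<c (toℕ<n c)
    m≡ : toℕ (fromℕ< m<k) ≡ m
    m≡ = toℕ-fromℕ< m<k

height : ∀ {k} → (Fin k → Bool) → ℕ
height {zero}  f = 0
height {suc k} f = if f zero then suc (height (f ∘ suc)) else 0

height-≤ : ∀ {k} (f : Fin k → Bool) → height f ≤ k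
height-≤ {zero}  f = z≤n
height-≤ {suc k} f with f zero
... | true  = s≤s (height-≤ (f ∘ suc))
... | false = z≤n

height-mono : ∀ {k} {f g : Fin k → Bool} → (∀ c → T (g c) → T (f c)) → height g ≤ height f
height-mono {zero} g⇒f = z≤n
height-mono {suc k} {f} {g} g⇒f with g zero in g₀ | f zero in f₀
... | false | _     = z≤n
... | true  | true  = s≤s (height-mono (g⇒f ∘ suc))
... | true  | false = contradiction (subst T f₀ (g⇒f zero (subst T (sym g₀) tt))) λ ()

DownClosed : ∀ {k} → (Fin k → Bool) → Set
DownClosed f = ∀ c c′ → toℕ c ≤ toℕ c′ → T (f c′) → T (f c)

height-spec : ∀ {k} {f : Fin k → Bool} → DownClosed f → ∀ c → T (f c) ⇔ toℕ c < height f
height-spec {suc k} {f} dc c with f zero in f₀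
height-spec {suc k} {f} dc zero    | true = mk⇔ (λ _ → s≤s z≤n) (λ _ → subst T (sym f₀) tt)
height-spec {suc k} {f} dc (suc c) | true =
  let tail⇔ = height-spec (λ c c′ → dc (suc c) (suc c′) ∘ s≤s) c in
  mk⇔ (s≤s ∘ to tail⇔) (from tail⇔ ∘ ≤-pred)
... | false = mk⇔ (λ fc → contradiction (subst T f₀ (dc zero c z≤n fc)) λ ()) λ ()

module Claw×Chain (n k : ℕ) where

  ∈-elements : (q : Elt n k) → q ∈ elements n k
  ∈-elements (x , c) = ∈-cartesianProduct⁺ {xs = nothing ∷ map just (allFin n)} (∈-claw x) (∈-allFin c)
    where
    ∈-claw : ∀ x → x ∈ nothing ∷ map just (allFin n)
    ∈-claw nothing  = here refl
    ∈-claw (just i) = there (∈-map⁺ just (∈-allFin i))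

  isMinOfComplement⇔ : ∀ (S : Subset n k) q →
                       T (isMinOfComplement S q) ⇔ (¬ T (S q) × (∀ q′ → T (q′ <P q) → T (S q′)))
  isMinOfComplement⇔ S q = mk⇔
    (λ t → let ∉S , below = to (T-∧ {not (S q)}) t in
      to T-not ∉S , λ q′ → to T-not-∧-not (All.lookup (all⁺ _ (elements n k) below) (∈-elements q′)))
    (λ (∉S , below) →
      from T-∧ (from T-not ∉S , all⁻ _ {elements n k} (tabulate λ {q′} _ → from T-not-∧-not (below q′))))

  rowmotion⇔ : ∀ (S : Subset n k) y →
               T (rowmotion S y) ⇔ (∃ λ q → T (isMinOfComplement S q) × T (y ≤P q))
  rowmotion⇔ S y = mk⇔
    (λ t → let q , min∧≤ = satisfied (any⁻ _ (elements n k) t) in q , to T-∧ min∧≤)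
    (λ (q , min , y≤q) → any⁺ _ (Any.map (λ { refl → from T-∧ (min , y≤q) }) (∈-elements q)))

  ⌊≟⌋-refl : ∀ (i : Fin n) → ⌊ i ≟ i ⌋ ≡ true
  ⌊≟⌋-refl i with i ≟ i
  ... | yes _  = refl
  ... | no i≢i = contradiction refl i≢i

  below-root : ∀ {x : Claw n} {c′ c : Fin k} → T ((x , c′) <P (nothing , c)) →
               x ≡ nothing × toℕ c′ < toℕ c
  below-root {nothing} {c′} {c} t = refl , to (T-≤ᵇ∧≱ᵇ (toℕ c′) (toℕ c)) t

  root<root : ∀ {c′ c : Fin k} → toℕ c′ < toℕ c → T ((nothing {A = Fin n} , c′) <P (nothing , c))
  root<root = from (T-≤ᵇ∧≱ᵇ _ _)

  below-arm : ∀ {x : Claw n} {c′ : Fin k} {i c} → T ((x , c′) <P (just i , c)) →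
              (x ≡ nothing × toℕ c′ ≤ toℕ c) ⊎ (x ≡ just i × toℕ c′ < toℕ c)
  below-arm {nothing} {c′} {i} {c} t = inj₁ (refl , ≤ᵇ⇒≤ (toℕ c′) (toℕ c) (proj₁ (to T-∧ t)))
  below-arm {just j} {c′} {i} {c} t with j ≟ i | t
  ... | yes refl | t′ = inj₂ (refl , to (T-≤ᵇ∧≱ᵇ (toℕ c′) (toℕ c)) (subst strict (⌊≟⌋-refl j) t′))
    where
    strict : Bool → Set
    strict b = T ((toℕ c′ ≤ᵇ toℕ c) ∧ not (b ∧ (toℕ c ≤ᵇ toℕ c′)))

  root<arm : ∀ {c′ : Fin k} {i : Fin n} {c} → toℕ c′ ≤ toℕ c → T ((nothing , c′) <P (just i , c))
  root<arm c′≤c = from T-∧ (≤⇒≤ᵇ c′≤c , tt)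

  arm<arm : ∀ {c′ : Fin k} {i : Fin n} {c} → toℕ c′ < toℕ c → T ((just i , c′) <P (just i , c))
  arm<arm {c′} {i} {c} c′<c = subst strict (sym (⌊≟⌋-refl i)) (root<root c′<c)
    where
    strict : Bool → Set
    strict b = T ((b ∧ (toℕ c′ ≤ᵇ toℕ c)) ∧ not (b ∧ (toℕ c ≤ᵇ toℕ c′)))

  root≤⇔ : ∀ {c : Fin k} {x : Claw n} {c₀} → T ((nothing , c) ≤P (x , c₀)) ⇔ toℕ c ≤ toℕ c₀
  root≤⇔ {c} {x} {c₀} = mk⇔ (≤ᵇ⇒≤ (toℕ c) (toℕ c₀)) ≤⇒≤ᵇ

  arm≤ : ∀ {i : Fin n} {c : Fin k} {j c₀} → T ((just i , c) ≤P (just j , c₀)) →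
         i ≡ j × toℕ c ≤ toℕ c₀
  arm≤ {i} {c} {j} {c₀} t with i ≟ j | t
  ... | yes refl | t′ = refl , ≤ᵇ⇒≤ (toℕ c) (toℕ c₀) t′

  arm≤arm : ∀ {i : Fin n} {c c₀ : Fin k} → toℕ c ≤ toℕ c₀ → T ((just i , c) ≤P (just i , c₀))
  arm≤arm {i} {c} {c₀} c≤c₀ =
    subst (λ b → T (b ∧ (toℕ c ≤ᵇ toℕ c₀))) (sym (⌊≟⌋-refl i)) (≤⇒≤ᵇ c≤c₀)

  record Heights : Set where
    constructor ⟨_,_⟩
    field
      root : ℕ
      arm  : Fin n → ℕ

  open Heights public

  record Admissible (h : Heights) : Set where
    constructor admissible
    field
      root≤k   : root h ≤ k
      arm≤root : ∀ i → arm h i ≤ root h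

  record Encodes (I : Subset n k) (h : Heights) : Set where
    constructor encodes
    field
      root-column : ∀ c → T (I (nothing , c)) ⇔ toℕ c < root h
      arm-column  : ∀ i c → T (I (just i , c)) ⇔ toℕ c < arm h i

  nextRoot : ℕ → (Fin n → ℕ) → ℕ
  nextRoot m arm′ with m <? k
  ... | yes _ = suc m
  ... | no  _ = maxᶠ arm′

  next : Heights → Heights
  next h = ⟨ nextRoot (root h) (λ i → advance (root h) (arm h i)) , (λ i → advance (root h) (arm h i)) ⟩

  next-admissible : ∀ {h} → Admissible h → Admissible (next h)
  next-admissible {h} (admissible root≤k _) with root h <? k
  ... | yes root<k = admissible root<k (λ i → m≤n⇒m≤1+n (advance-≤ (root h) (arm h i)))
  ... | no  _      =
    admissible (maxᶠ-≤ _ (λ i → ≤-trans (advance-≤ (root h) (arm h i)) root≤k)) (≤-maxᶠ _)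

  module _ {I h} (enc : Encodes I h) where
    open Encodes enc

    isMin-root⇔ : ∀ c → T (isMinOfComplement I (nothing , c)) ⇔ toℕ c ≡ root h
    isMin-root⇔ c = mk⇔ to′ from′
      where
      to′ : T (isMinOfComplement I (nothing , c)) → toℕ c ≡ root h
      to′ t = let ∉I , below = to (isMinOfComplement⇔ I _) t in
        column-boundary c (∉I ∘ from (root-column c))
          (λ c′ c′<c → to (root-column c′) (below (nothing , c′) (root<root {c′} {c} c′<c)))
      from′ : toℕ c ≡ root h → T (isMinOfComplement I (nothing , c))
      from′ refl = from (isMinOfComplement⇔ I _) (n≮n _ ∘ to (root-column c) , below)
        where
        below : ∀ q′ → T (q′ <P (nothing , c)) → T (I q′)
        below (x , c′) t with below-root {x} {c′} {c} t
        ... | refl , c′<c = from (root-column c′) c′<c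

    isMin-arm⇔ : ∀ i c → T (isMinOfComplement I (just i , c)) ⇔ (toℕ c ≡ arm h i × toℕ c < root h)
    isMin-arm⇔ i c = mk⇔ to′ from′
      where
      to′ : T (isMinOfComplement I (just i , c)) → toℕ c ≡ arm h i × toℕ c < root h
      to′ t = let ∉I , below = to (isMinOfComplement⇔ I _) t in
        column-boundary c (∉I ∘ from (arm-column i c))
          (λ c′ c′<c → to (arm-column i c′) (below (just i , c′) (arm<arm {c′} {i} {c} c′<c))) ,
        to (root-column c) (below (nothing , c) (root<arm {c} {i} {c} ≤-refl))
      from′ : toℕ c ≡ arm h i × toℕ c < root h → T (isMinOfComplement I (just i , c))
      from′ (c≡arm , c<root) =
        from (isMinOfComplement⇔ I _) (n≮n _ ∘ subst (toℕ c <_) (sym c≡arm) ∘ to (arm-column i c) , below)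
        where
        below : ∀ q′ → T (q′ <P (just i , c)) → T (I q′)
        below (x , c′) t with below-arm {x} {c′} {i} {c} t
        ... | inj₁ (refl , c′≤c) = from (root-column c′) (≤-<-trans c′≤c c<root)
        ... | inj₂ (refl , c′<c) = from (arm-column i c′) (subst (toℕ c′ <_) c≡arm c′<c)

    module _ (adm : Admissible h) where
      open Admissible adm

      minimal-at-arm : ∀ i → arm h i < root h →
                       ∃ λ c₀ → toℕ c₀ ≡ arm h i × T (isMinOfComplement I (just i , c₀))
      minimal-at-arm i arm<root =
        c₀ , c₀≡arm , from (isMin-arm⇔ i c₀) (c₀≡arm , subst (_< root h) (sym c₀≡arm) arm<root)
        where
        c₀ : Fin k
        c₀ = fromℕ< (<-≤-trans arm<root root≤k)
        c₀≡arm : toℕ c₀ ≡ arm h i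
        c₀≡arm = toℕ-fromℕ< _

      rowmotion-arm⇔ : ∀ i c → T (rowmotion I (just i , c)) ⇔ toℕ c < advance (root h) (arm h i)
      rowmotion-arm⇔ i c = mk⇔ to′ from′
        where
        to′ : T (rowmotion I (just i , c)) → toℕ c < advance (root h) (arm h i)
        to′ t with to (rowmotion⇔ I (just i , c)) t
        ... | (nothing , c₀) , _ , ()
        ... | (just j , c₀) , min , le with arm≤ {i} {c} {j} {c₀} le | to (isMin-arm⇔ j c₀) min
        ...   | refl , c≤c₀ | c₀≡arm , c₀<root = subst (toℕ c <_)
          (sym (advance-< (subst (_< root h) c₀≡arm c₀<root))) (s≤s (subst (toℕ c ≤_) c₀≡arm c≤c₀))
        from′ : toℕ c < advance (root h) (arm h i) → T (rowmotion I (just i , c))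
        from′ c< with <-advance c<
        ... | arm<root , c≤arm with minimal-at-arm i arm<root
        ...   | c₀ , c₀≡arm , min = from (rowmotion⇔ I (just i , c))
          ((just i , c₀) , min , arm≤arm {i} {c} {c₀} (subst (toℕ c ≤_) (sym c₀≡arm) c≤arm))

      rowmotion-root⇔ : ∀ c → T (rowmotion I (nothing , c)) ⇔ toℕ c < root (next h)
      rowmotion-root⇔ c = mk⇔ to′ from′
        where
        to′ : T (rowmotion I (nothing , c)) → toℕ c < root (next h)
        to′ t with to (rowmotion⇔ I (nothing , c)) t
        ... | (nothing , c₀) , min , le with to (isMin-root⇔ c₀) min | root h <? k
        ...   | c₀≡root | yes _     =
          s≤s (subst (toℕ c ≤_) c₀≡root (to (root≤⇔ {c} {nothing} {c₀}) le))
        ...   | c₀≡root | no root≮k = contradiction (subst (_< k) c₀≡root (toℕ<n c₀)) root≮k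
        to′ t | (just j , c₀) , min , le with to (isMin-arm⇔ j c₀) min
        ...   | c₀≡arm , c₀<root = <-≤-trans c<next-arm (Admissible.arm≤root (next-admissible adm) j)
          where
          c<next-arm : toℕ c < advance (root h) (arm h j)
          c<next-arm = subst (toℕ c <_) (sym (advance-< (subst (_< root h) c₀≡arm c₀<root)))
                             (s≤s (subst (toℕ c ≤_) c₀≡arm (to (root≤⇔ {c} {just j} {c₀}) le)))
        from′ : toℕ c < root (next h) → T (rowmotion I (nothing , c))
        from′ c< with root h <? k
        ... | yes root<k = from (rowmotion⇔ I (nothing , c))
          ((nothing , c₀) , from (isMin-root⇔ c₀) (toℕ-fromℕ< _) ,
           from (root≤⇔ {c} {nothing} {c₀}) (subst (toℕ c ≤_) (sym (toℕ-fromℕ< _)) (≤-pred c<)))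
          where
          c₀ : Fin k
          c₀ = fromℕ< root<k
        ... | no _ with <-maxᶠ _ c<
        ...   | j , c<next-arm with <-advance c<next-arm
        ...     | arm<root , c≤arm with minimal-at-arm j arm<root
        ...       | c₀ , c₀≡arm , min = from (rowmotion⇔ I (nothing , c))
          ((just j , c₀) , min , from (root≤⇔ {c} {just j} {c₀}) (subst (toℕ c ≤_) (sym c₀≡arm) c≤arm))

      rowmotion-encodes : Encodes (rowmotion I) (next h)
      rowmotion-encodes = encodes rowmotion-root⇔ rowmotion-arm⇔

  encoding : ∀ {I} → IsOrderIdeal I → ∃ λ h → Admissible h × Encodes I h
  encoding {I} ideal =
    ⟨ height rootColumn , (λ i → height (armColumn i)) ⟩ ,
    admissible (height-≤ rootColumn)
               (λ i → height-mono (λ c → below (nothing , c) (just i , c) (≤⇒≤ᵇ (≤-refl {toℕ c})))) ,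
    encodes (height-spec (λ c c′ c≤c′ → below (nothing , c) (nothing , c′) (≤⇒≤ᵇ c≤c′)))
            (λ i → height-spec (λ c c′ c≤c′ → below (just i , c) (just i , c′) (arm≤arm {i} {c} {c′} c≤c′)))
    where
    rootColumn : Fin k → Bool
    rootColumn c = I (nothing , c)
    armColumn : Fin n → Fin k → Bool
    armColumn i c = I (just i , c)
    below : ∀ p q → T (p ≤P q) → T (I q) → T (I p)
    below p q p≤q Iq = from T-≡ (ideal p q (to T-≡ p≤q) (to T-≡ Iq))

  iterate-admissible : ∀ {h} → Admissible h → ∀ t → Admissible (iterate next t h)
  iterate-admissible adm zero    = adm
  iterate-admissible adm (suc t) = next-admissible (iterate-admissible adm t)

  iterate-encodes : ∀ {I h} → Admissible h → Encodes I h → ∀ t →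
                    Encodes (iterate rowmotion t I) (iterate next t h)
  iterate-encodes adm enc zero    = enc
  iterate-encodes adm enc (suc t) = rowmotion-encodes (iterate-encodes adm enc t) (iterate-admissible adm t)

  module _ {{_ : NonZero n}} where
    open Particles k

    Pinned : Heights → Set
    Pinned h = ∃ λ i → arm h i ≡ root h

    pinned? : ∀ h → Dec (Pinned h)
    pinned? h = any? (λ i → arm h i ≟ℕ root h)

    hole : Heights → ℕ
    hole h with pinned? h
    ... | yes _ = suc k
    ... | no  _ = root h

    hole-cases : ∀ h → (Pinned h × hole h ≡ suc k) ⊎ (¬ Pinned h × hole h ≡ root h)
    hole-cases h with pinned? h
    ... | yes pinned   = inj₁ (pinned , refl)
    ... | no  unpinned = inj₂ (unpinned , refl)

    Occupied : Heights → ℕ → Set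
    Occupied h y = (∃ λ i → arm h i ≡ y) ⊎ hole h ≡ y

    occupied? : ∀ h y → Dec (Occupied h y)
    occupied? h y = any? (λ i → arm h i ≟ℕ y) ⊎-dec (hole h ≟ℕ y)

    env : Heights → Env
    env h y = does (occupied? h y)

    env⇔ : ∀ h y → env h y ≡ true ⇔ Occupied h y
    env⇔ h y = does≡true⇔ (occupied? h y)

    hole-next : ∀ {h} → Admissible h → hole (next h) ≡ suc (root h)
    hole-next {h} (admissible root≤k _) with root h <? k
    ... | yes root<k with any? (λ i → advance (root h) (arm h i) ≟ℕ suc (root h))
    ...   | yes (i , arm′≡) =
      contradiction (subst (_≤ root h) arm′≡ (advance-≤ (root h) (arm h i))) (n≮n (root h))
    ...   | no  _           = refl
    hole-next {h} (admissible root≤k _) | no root≮k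
      with any? (λ i → advance (root h) (arm h i) ≟ℕ maxᶠ (λ i → advance (root h) (arm h i)))
    ...   | yes _       = cong suc (≤-antisym (≮⇒≥ root≮k) root≤k)
    ...   | no unpinned = contradiction (maxᶠ-attained (fromℕ< (>-nonZero⁻¹ n)) _) unpinned

    module _ {h} (adm : Admissible h) where
      open Admissible adm

      hole≡root : ∀ {y} → y ≤ k → hole h ≡ y → hole h ≡ root h
      hole≡root {y} y≤k hole≡y with hole-cases h
      ... | inj₁ (_ , hole≡) = contradiction (subst (_≤ k) (trans (sym hole≡y) hole≡) y≤k) (n≮n k)
      ... | inj₂ (_ , hole≡) = hole≡

      arm<hole : ∀ i → arm h i < hole h
      arm<hole i with hole-cases h
      ... | inj₁ (_ , hole≡) = subst (arm h i <_) (sym hole≡) (s≤s (≤-trans (arm≤root i) root≤k))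
      ... | inj₂ (unpinned , hole≡) =
        subst (arm h i <_) (sym hole≡) (≤∧≢⇒< (arm≤root i) (λ arm≡root → unpinned (i , arm≡root)))

      hole-≤ : hole h ≤ suc k
      hole-≤ with hole-cases h
      ... | inj₁ (_ , hole≡) = ≤-reflexive hole≡
      ... | inj₂ (_ , hole≡) = subst (_≤ suc k) (sym hole≡) (m≤n⇒m≤1+n root≤k)

      root-occupied : Occupied h (root h)
      root-occupied with hole-cases h
      ... | inj₁ (pinned , _) = inj₁ pinned
      ... | inj₂ (_ , hole≡)  = inj₂ hole≡

      env-hole : env h (hole h) ≡ true
      env-hole = from (env⇔ h (hole h)) (inj₂ refl)

      env-arm : ∀ i → env h (arm h i) ≡ true
      env-arm i = from (env⇔ h (arm h i)) (inj₁ (i , refl))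

      env-above-hole : Gap (env h) (hole h) period
      env-above-hole z hole<z _ = ¬-not unoccupied
        where
        unoccupied : env h z ≢ true
        unoccupied envz with to (env⇔ h z) envz
        ... | inj₁ (i , arm≡z) = <-asym (arm<hole i) (subst (hole h <_) (sym arm≡z) hole<z)
        ... | inj₂ hole≡z      = <-irrefl hole≡z hole<z

      advance≡move : ∀ i → advance (root h) (arm h i) ≡ move (env h) (arm h i)
      advance≡move i with advance-cases (root h) (arm h i)
      ... | inj₁ (arm<root , advance≡) =
        trans advance≡ (sym (move-up (root h , s≤s root≤k , arm<root , from (env⇔ h (root h)) root-occupied)))
      ... | inj₂ (arm≮root , advance≡) = trans advance≡ (sym (move-drop no-point))
        where
        root≤arm : root h ≤ arm h i
        root≤arm = ≮⇒≥ arm≮root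
        no-point : ¬ PointAbove (env h) (arm h i)
        no-point (y , y<1+k , arm<y , envy) with to (env⇔ h y) envy
        ... | inj₁ (j , arm≡y) = <-irrefl arm≡y (≤-<-trans (≤-trans (arm≤root j) root≤arm) arm<y)
        ... | inj₂ hole≡y      =
          <-irrefl (trans (sym (hole≡root (≤-pred y<1+k) hole≡y)) hole≡y) (≤-<-trans root≤arm arm<y)

      env-next : env (next h) ≈ rotate (env h)
      env-next zero _ = does-⇔ (mk⇔ to′ from′) (occupied? (next h) 0) (occupied? h (suc k))
        where
        to′ : Occupied (next h) 0 → Occupied h (suc k)
        to′ (inj₁ (i , advance≡0)) with advance-cases (root h) (arm h i) | hole-cases h
        ... | inj₁ (_ , advance≡) | _                   = contradiction (trans (sym advance≡) advance≡0) λ ()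
        ... | inj₂ _              | inj₁ (_ , hole≡)    = inj₂ hole≡
        ... | inj₂ (arm≮root , _) | inj₂ (unpinned , _) =
          contradiction (i , ≤-antisym (arm≤root i) (≮⇒≥ arm≮root)) unpinned
        to′ (inj₂ hole≡0) = contradiction (trans (sym (hole-next adm)) hole≡0) λ ()
        from′ : Occupied h (suc k) → Occupied (next h) 0
        from′ (inj₁ (i , arm≡)) =
          contradiction (subst (_≤ k) arm≡ (≤-trans (arm≤root i) root≤k)) (n≮n k)
        from′ (inj₂ hole≡) with hole-cases h
        ... | inj₁ ((i , arm≡root) , _) with advance-cases (root h) (arm h i)
        ...   | inj₁ (arm<root , _) = contradiction (subst (_< root h) arm≡root arm<root) (n≮n (root h))
        ...   | inj₂ (_ , advance≡) = inj₁ (i , advance≡)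
        from′ (inj₂ hole≡) | inj₂ (_ , hole≡root) =
          contradiction (subst (_≤ k) (trans (sym hole≡root) hole≡) root≤k) (n≮n k)
      env-next (suc y) 1+y≤ = does-⇔ (mk⇔ to′ from′) (occupied? (next h) (suc y)) (occupied? h y)
        where
        to′ : Occupied (next h) (suc y) → Occupied h y
        to′ (inj₁ (i , advance≡)) with advance-cases (root h) (arm h i)
        ... | inj₁ (_ , advance≡′) = inj₁ (i , suc-injective (trans (sym advance≡′) advance≡))
        ... | inj₂ (_ , advance≡′) = contradiction (trans (sym advance≡′) advance≡) λ ()
        to′ (inj₂ hole≡) = subst (Occupied h) (suc-injective (trans (sym (hole-next adm)) hole≡)) root-occupied
        from′ : Occupied h y → Occupied (next h) (suc y)
        from′ (inj₁ (i , arm≡y)) with advance-cases (root h) (arm h i)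
        ... | inj₁ (_ , advance≡) = inj₁ (i , trans advance≡ (cong suc arm≡y))
        ... | inj₂ (arm≮root , _) =
          inj₂ (trans (hole-next adm) (cong suc (trans (≤-antisym (≮⇒≥ arm≮root) (arm≤root i)) arm≡y)))
        from′ (inj₂ hole≡y) =
          inj₂ (trans (hole-next adm) (cong suc (trans (sym (hole≡root (≤-pred 1+y≤) hole≡y)) hole≡y)))

    env-iterate : ∀ {h} → Admissible h → ∀ t → env (iterate next t h) ≈ iterate rotate t (env h)
    env-iterate adm zero    y y≤ = refl
    env-iterate adm (suc t) y y≤ =
      trans (env-next (iterate-admissible adm t) y y≤) (rotate-cong (env-iterate adm t) y y≤)

    arm-position : ∀ {h} → Admissible h → ∀ i t → arm (iterate next t h) i ≡ position (env h) (arm h i) t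
    arm-position adm i zero    = refl
    arm-position {h} adm i (suc t) = begin
      advance (root hₜ) (arm hₜ i)                                    ≡⟨ advance≡move admₜ i ⟩
      move (env hₜ) (arm hₜ i)                                         ≡⟨ move-cong (env-iterate adm t) _ ⟩
      move (iterate rotate t (env h)) (arm hₜ i)                       ≡⟨ cong (move _) (arm-position adm i t) ⟩
      move (iterate rotate t (env h)) (position (env h) (arm h i) t)  ∎
      where
      open ≡-Reasoning
      hₜ : Heights
      hₜ = iterate next t h
      admₜ : Admissible hₜ
      admₜ = iterate-admissible adm t

    arm-shift : ∀ {h} → Admissible h → ∀ i j →
                ∃ λ D → ∀ t → arm (iterate next (t + D) h) i ≡ arm (iterate next t h) j
    arm-shift {h} adm i j with shifted (hole-≤ adm) (env-hole adm) (env-above-hole adm)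
                                      (env-arm adm i) (arm<hole adm i) (env-arm adm j) (arm<hole adm j)
    ... | D , shift = D , λ t → trans (arm-position adm i (t + D)) (trans (shift t) (sym (arm-position adm j t)))

    column-shift : ∀ {I} → IsOrderIdeal I → ∀ i j a → ∃ λ D → ∀ t →
                   iterate rowmotion t (iterate rowmotion D I) (just i , a) ≡ iterate rowmotion t I (just j , a)
    column-shift {I} ideal i j a with encoding ideal
    ... | h , adm , enc with arm-shift adm i j
    ...   | D , shift = D , λ t → T-injective (begin
      T (iterate rowmotion t (iterate rowmotion D I) (just i , a))  ≡⟨ cong (λ S → T (S (just i , a))) (iterate-+ _ t D I) ⟩
      T (iterate rowmotion (t + D) I (just i , a))                  ≈⟨ column (t + D) i ⟩
      toℕ a < arm (iterate next (t + D) h) i                        ≡⟨ cong (toℕ a <_) (shift t) ⟩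
      toℕ a < arm (iterate next t h) j                              ≈⟨ column t j ⟨
      T (iterate rowmotion t I (just j , a))                        ∎)
      where
      open SetoidReasoning (⇔-setoid 0ℓ)
      column : ∀ t i → T (iterate rowmotion t I (just i , a)) ⇔ toℕ a < arm (iterate next t h) i
      column t i = Encodes.arm-column (iterate-encodes adm enc t) i a

rowmotion-cong : ∀ {n k} {S S′ : Subset n k} → S ≐ S′ → rowmotion S ≐ rowmotion S′
rowmotion-cong {n} {k} {S} {S′} S≐S′ y =
  cong or (map-cong (λ q → cong (_∧ (y ≤P q)) (isMin-cong q)) (elements n k))
  where
  isMin-cong : ∀ q → isMinOfComplement S q ≡ isMinOfComplement S′ q
  isMin-cong q = cong₂ _∧_ (cong not (S≐S′ q))
    (cong and (map-cong (λ q′ → cong (λ b → not (not b ∧ (q′ <P q))) (S≐S′ q′)) (elements n k)))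

iterate-rowmotion-cong : ∀ {n k} {S S′ : Subset n k} → S ≐ S′ →
                         ∀ t → iterate rowmotion t S ≐ iterate rowmotion t S′
iterate-rowmotion-cong S≐S′ zero    = S≐S′
iterate-rowmotion-cong S≐S′ (suc t) = rowmotion-cong (iterate-rowmotion-cong S≐S′ t)

module _ {n k : ℕ} where

  orbitSum-cong : ∀ {f g : Subset n k → ℤ} {I J} →
                  (∀ t → f (iterate rowmotion t I) ≡ g (iterate rowmotion t J)) →
                  ∀ p → orbitSum f I p ≡ orbitSum g J p
  orbitSum-cong f≡g zero    = refl
  orbitSum-cong f≡g (suc p) = cong₂ ℤ._+_ (orbitSum-cong f≡g p) (f≡g p)

  orbitSum-─ : ∀ (f g : Subset n k → ℤ) I p →
               orbitSum (λ S → f S - g S) I p ≡ orbitSum f I p - orbitSum g I p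
  orbitSum-─ f g I zero    = refl
  orbitSum-─ f g I (suc p) rewrite orbitSum-─ f g I p =
    regroup (orbitSum f I p) (orbitSum g I p) (f (iterate rowmotion p I)) (g (iterate rowmotion p I))
    where
    regroup : ∀ a b x y → (a - b) ℤ.+ (x - y) ≡ (a ℤ.+ x) - (b ℤ.+ y)
    regroup = ℤ-Solver.solve-∀

  orbitSum-rowmotion : ∀ (f : Subset n k → ℤ) I p → f (iterate rowmotion p I) ≡ f I →
                       orbitSum f (rowmotion I) p ≡ orbitSum f I p
  orbitSum-rowmotion f I p periodic =
    ∙-cancelʳ (f I) _ _ (trans (telescope p) (cong (ℤ._+_ (orbitSum f I p)) periodic))
    where
    swap : ∀ a x c → (a ℤ.+ x) ℤ.+ c ≡ (a ℤ.+ c) ℤ.+ x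
    swap = ℤ-Solver.solve-∀
    telescope : ∀ p → orbitSum f (rowmotion I) p ℤ.+ f I ≡ orbitSum f I p ℤ.+ f (iterate rowmotion p I)
    telescope zero    = refl
    telescope (suc p) = begin
      orbitSum f (rowmotion I) p ℤ.+ f (iterate rowmotion p (rowmotion I)) ℤ.+ f I
        ≡⟨ cong (λ t → orbitSum f (rowmotion I) p ℤ.+ f t ℤ.+ f I)
                (trans (iterate-+ rowmotion p 1 I) (cong (λ s → iterate rowmotion s I) (+-comm p 1))) ⟩
      orbitSum f (rowmotion I) p ℤ.+ f (iterate rowmotion (suc p) I) ℤ.+ f I
        ≡⟨ swap (orbitSum f (rowmotion I) p) (f (iterate rowmotion (suc p) I)) (f I) ⟩
      orbitSum f (rowmotion I) p ℤ.+ f I ℤ.+ f (iterate rowmotion (suc p) I)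
        ≡⟨ cong (ℤ._+ f (iterate rowmotion (suc p) I)) (telescope p) ⟩
      orbitSum f I p ℤ.+ f (iterate rowmotion p I) ℤ.+ f (iterate rowmotion (suc p) I) ∎
      where open ≡-Reasoning

  orbitSum-iterate : ∀ (f : Subset n k → ℤ) → (∀ {S S′} → S ≐ S′ → f S ≡ f S′) → ∀ {I p} →
                     iterate rowmotion p I ≐ I → ∀ D → orbitSum f (iterate rowmotion D I) p ≡ orbitSum f I p
  orbitSum-iterate f f-cong         periodic zero    = refl
  orbitSum-iterate f f-cong {I} {p} periodic (suc D) =
    trans (orbitSum-rowmotion f Iᴰ p (f-cong {iterate rowmotion p Iᴰ} {Iᴰ} periodicᴰ))
          (orbitSum-iterate f f-cong {I} {p} periodic D)
    where
    Iᴰ : Subset n k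
    Iᴰ = iterate rowmotion D I
    periodicᴰ : iterate rowmotion p Iᴰ ≐ Iᴰ
    periodicᴰ y = begin
      iterate rowmotion p Iᴰ y                       ≡⟨ cong (λ S → S y) (iterate-+ rowmotion p D I) ⟩
      iterate rowmotion (p + D) I y                  ≡⟨ cong (λ t → iterate rowmotion t I y) (+-comm p D) ⟩
      iterate rowmotion (D + p) I y                  ≡⟨ cong (λ S → S y) (iterate-+ rowmotion D p I) ⟨
      iterate rowmotion D (iterate rowmotion p I) y  ≡⟨ iterate-rowmotion-cong periodic D y ⟩
      Iᴰ y                                           ∎
      where open ≡-Reasoning

χ-cong : ∀ {n k} (i : Fin n) (a : Fin k) {S S′ : Subset n k} → S ≐ S′ → χ i a S ≡ χ i a S′
χ-cong i a S≐S′ = cong (if_then ℤ.+ 1 else ℤ.+ 0) (S≐S′ (just i , a))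

theorem4p12 : (n k : ℕ) → NonZero n → NonZero k → (i j : Fin n) → (a : Fin k)
    → IsZeroMesic {n} {k} (λ I → χ i a I - χ j a I)
theorem4p12 n k n≢0 _ i j a I ideal p (_ , periodic , _) with Claw×Chain.column-shift n k {{n≢0}} ideal i j a
... | D , shift = begin
  orbitSum (λ S → χ i a S - χ j a S) I p                             ≡⟨ orbitSum-─ (χ i a) (χ j a) I p ⟩
  orbitSum (χ i a) I p - orbitSum (χ j a) I p                         ≡⟨ cong (_- _) rotated ⟨
  orbitSum (χ i a) (iterate rowmotion D I) p - orbitSum (χ j a) I p   ≡⟨ cong (_- _) shifted ⟩
  orbitSum (χ j a) I p - orbitSum (χ j a) I p                         ≡⟨ ℤ.+-inverseʳ (orbitSum (χ j a) I p) ⟩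
  ℤ.+ 0                                                               ∎
  where
  open ≡-Reasoning
  rotated : orbitSum (χ i a) (iterate rowmotion D I) p ≡ orbitSum (χ i a) I p
  rotated = orbitSum-iterate (χ i a) (χ-cong i a) {I} {p} periodic D
  shifted : orbitSum (χ i a) (iterate rowmotion D I) p ≡ orbitSum (χ j a) I p
  shifted = orbitSum-cong (cong (if_then ℤ.+ 1 else ℤ.+ 0) ∘ shift) p
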